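{- For every dealing pattern $P$ and integers $1\le k\le N$: \[T^{DP}_{N,k}=\begin{cases}1,& k=1,\\ T^{P}_{N-1,k-1}+1,& k>1,\end{cases}\qquad T^{UP}_{N,k}=\begin{cases}T^{P}_{N,N},& k=1,\\ T^{P}_{N,k-1},& k>1.\end{cases}\]
   Context: A dealing pattern $P=P_1P_2P_3\cdots$ is an infinite sequence of letters $U$ and $D$ containing infinitely many $D$'s. Dealing a deck of $N$ cards (positions $1,\dots,N$ from the top) by $P$ means: process the letters in order; for a $U$ move the top card to the bottom; for a $D$ remove the top card (deal it); stop when all $N$ cards are dealt. The dealing triangle $T^P$ is defined by: for $1\le k\le N$, $T^P_{N,k}$ is the number $j$ such that the card initially at position $k$ is the $j$th card dealt. $DP$ (resp. $UP$) denotes the pattern obtained by prepending $D$ (resp. $U$) to $P$. -}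

module Defs where

open import Data.Nat using (ℕ; zero; suc; _+_; _∸_; _≤_; _<_; z≤n; s≤s)
open import Data.Nat.Properties using (m+[n∸m]≡n; ≤-trans; n≤1+n; +-monoʳ-≤)
open import Data.Product using (Σ; ∃; ∃-syntax; _×_; _,_; proj₁; proj₂)
open import Data.Vec using (Vec; []; _∷_; _∷ʳ_; head; tail)
open import Relation.Binary.PropositionalEquality using (_≡_; refl; subst; sym; cong)
open import Relation.Nullary using (yes; no)
open import Data.Nat using (_≟_)

data Letter : Set where
  U D : Letter

record Pattern : Set where
  constructor mkPattern
  field
    letter : ℕ → Letter
    infD   : ∀ n → ∃[ m ] (n ≤ m × letter m ≡ D)
open Pattern public

_∷ᴾ_ : Letter → Pattern → Pattern
l ∷ᴾ p = mkPattern f inf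
  where
  f : ℕ → Letter
  f zero    = l
  f (suc i) = letter p i
  inf : ∀ n → ∃[ m ] (n ≤ m × f m ≡ D)
  inf n with infD p n
  ... | m , n≤m , eq = suc m , ≤-trans n≤m (n≤1+n m) , eq

tailᴾ : Pattern → Pattern
tailᴾ p = mkPattern (λ i → letter p (suc i)) inf
  where
  inf : ∀ n → ∃[ m ] (n ≤ m × letter p (suc m) ≡ D)
  inf n with infD p (suc n)
  ... | suc m , s≤s n≤m , eq = m , n≤m , eq

dropᴾ : ℕ → Pattern → Pattern
dropᴾ zero    p = p
dropᴾ (suc k) p = dropᴾ k (tailᴾ p)

-- Index of the first D in f, searching positions 0..b (b is a bound at
-- which a D is known to occur, so the result is the true first D).
searchD : (ℕ → Letter) → ℕ → ℕ
searchD f zero    = zero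
searchD f (suc b) with f zero
... | D = zero
... | U = suc (searchD (λ i → f (suc i)) b)

firstD : Pattern → ℕ
firstD p = searchD (letter p) (proj₁ (infD p zero))

rotate : ∀ {n} → ℕ → Vec ℕ (suc n) → Vec ℕ (suc n)
rotate zero    v        = v
rotate (suc k) (x ∷ xs) = rotate k (xs ∷ʳ x)

-- Deal a deck (top first) by a pattern; returns the cards in the order
-- they are dealt.
deal : ∀ {n} → Pattern → Vec ℕ n → Vec ℕ n
deal p []         = []
deal p (c ∷ cs) with rotate (firstD p) (c ∷ cs)
... | top ∷ rest = top ∷ deal (dropᴾ (suc (firstD p)) p) rest

-- The deck 1,2,...,N labelled by initial positions from the top.
deckFrom : ∀ (s n : ℕ) → Vec ℕ n
deckFrom s zero    = []
deckFrom s (suc n) = s ∷ deckFrom (suc s) n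

deck : (N : ℕ) → Vec ℕ N
deck N = deckFrom 1 N

-- 1-based position of the first occurrence of x in a vector (0 if absent).
indexOf : ∀ {n} → ℕ → Vec ℕ n → ℕ
indexOf x []       = zero
indexOf x (y ∷ ys) with x ≟ y
... | yes _ = 1
... | no  _ = suc (indexOf x ys)

-- Dealing triangle: T P N k = j iff the card initially at position k is
-- the j-th card dealt when dealing N cards by P.
T : Pattern → ℕ → ℕ → ℕ
T p N k = indexOf k (deal p (deck N))

{-# OPTIONS --safe #-}
module Submission where

open import Defs
open import Data.Nat using (ℕ; zero; suc; _+_; _∸_; _≤_; _<_; _⊔_; _≟_; z≤n; s≤s)
open import Data.Nat.Properties using (+-comm; +-suc; +-identityʳ; suc-injective; <-irrefl; m<m+n; m≤m⊔n; m≤n⊔m)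
open import Data.Product using (_×_; _,_)
open import Data.Vec using (Vec; []; _∷_; _∷ʳ_; head; tail; map)
open import Data.Vec.Properties using (map-∷ʳ)
open import Function.Definitions using (Injective)
open import Relation.Nullary using (yes; no; contradiction)
open import Relation.Binary.PropositionalEquality
  using (_≡_; _≗_; refl; sym; trans; cong; cong₂; module ≡-Reasoning)

-- Dealing by DP deals the top card and then deals the rest by P; dealing by UP
-- deals the deck with its top card moved to the bottom by P.  In both cases the
-- new deck is a relabelling of a standard deck (by suc, resp. by the cycle
-- 1 ↦ 2 ↦ ⋯ ↦ N ↦ 1), and dealing commutes with relabelling, so the position
-- of a card in the dealt sequence is read off from the triangle of P.

-- D ∷ᴾ P and U ∷ᴾ P, once their first letter is dropped, have the letters of P but
-- not its proof of infD, which fixes the search bound in firstD; hence the need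
-- to show that dealing depends on the letters only.
_≗ᴾ_ : Pattern → Pattern → Set
p ≗ᴾ q = letter p ≗ letter q

searchD-stable : ∀ f {m b} → f m ≡ D → m ≤ b → searchD f b ≡ searchD f m
searchD-stable f {zero}  {zero}  _  _ = refl
searchD-stable f {zero}  {suc b} fm≡D _ with f zero
searchD-stable f {zero}  {suc b} refl _ | .D = refl
searchD-stable f {suc m} {suc b} fm≡D (s≤s m≤b) with f zero
... | D = refl
... | U = cong suc (searchD-stable (λ i → f (suc i)) fm≡D m≤b)

searchD-cong : ∀ {f g} → f ≗ g → ∀ b → searchD f b ≡ searchD g b
searchD-cong f≗g zero = refl
searchD-cong {f} {g} f≗g (suc b) with f zero | g zero | f≗g zero
... | D | .D | refl = refl
... | U | .U | refl = cong suc (searchD-cong (λ i → f≗g (suc i)) b)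

firstD-cong : ∀ {p q} → p ≗ᴾ q → firstD p ≡ firstD q
firstD-cong {p} {q} p≗q with infD p zero | infD q zero
... | m , _ , pm≡D | n , _ , qn≡D = begin
  searchD (letter p) m        ≡⟨ sym (searchD-stable (letter p) pm≡D (m≤m⊔n m n)) ⟩
  searchD (letter p) (m ⊔ n)  ≡⟨ searchD-cong p≗q (m ⊔ n) ⟩
  searchD (letter q) (m ⊔ n)  ≡⟨ searchD-stable (letter q) qn≡D (m≤n⊔m m n) ⟩
  searchD (letter q) n        ∎
  where open ≡-Reasoning

letter-dropᴾ : ∀ j p i → letter (dropᴾ j p) i ≡ letter p (j + i)
letter-dropᴾ zero    p i = refl
letter-dropᴾ (suc j) p i = letter-dropᴾ j (tailᴾ p) i

dropᴾ-cong : ∀ j {p q} → p ≗ᴾ q → dropᴾ j p ≗ᴾ dropᴾ j q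
dropᴾ-cong j {p} {q} p≗q i =
  trans (letter-dropᴾ j p i) (trans (p≗q (j + i)) (sym (letter-dropᴾ j q i)))

dealRound : ∀ {n} → Pattern → ℕ → Vec ℕ (suc n) → Vec ℕ (suc n)
dealRound p k v = head (rotate k v) ∷ deal (dropᴾ (suc k) p) (tail (rotate k v))

deal-suc : ∀ {n} p (v : Vec ℕ (suc n)) → deal p v ≡ dealRound p (firstD p) v
deal-suc p (c ∷ cs) with rotate (firstD p) (c ∷ cs)
... | top ∷ rest = refl

deal-cong : ∀ {n p q} → p ≗ᴾ q → (v : Vec ℕ n) → deal p v ≡ deal q v
deal-cong         p≗q [] = refl
deal-cong {p = p} {q} p≗q v@(_ ∷ _) = begin
  deal p v                 ≡⟨ deal-suc p v ⟩
  dealRound p (firstD p) v ≡⟨ cong (λ k → dealRound p k v) (firstD-cong {p} {q} p≗q) ⟩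
  dealRound p k v          ≡⟨ cong (head (rotate k v) ∷_) rest-cong ⟩
  dealRound q k v          ≡⟨ sym (deal-suc q v) ⟩
  deal q v                 ∎
  where
  open ≡-Reasoning
  k = firstD q
  p′ = dropᴾ (suc k) p
  q′ = dropᴾ (suc k) q
  rest = tail (rotate k v)
  rest-cong : deal p′ rest ≡ deal q′ rest
  rest-cong = deal-cong {p = p′} {q′} (dropᴾ-cong (suc k) {p} {q} p≗q) rest

rotate-map : ∀ {n} (f : ℕ → ℕ) k (v : Vec ℕ (suc n)) → rotate k (map f v) ≡ map f (rotate k v)
rotate-map f zero    v        = refl
rotate-map f (suc k) (x ∷ xs) rewrite sym (map-∷ʳ f x xs) = rotate-map f k (xs ∷ʳ x)

deal-map : ∀ {n} (f : ℕ → ℕ) p (v : Vec ℕ n) → deal p (map f v) ≡ map f (deal p v)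
deal-map f p [] = refl
deal-map f p v@(_ ∷ _) = begin
  deal p (map f v)                          ≡⟨ deal-suc p (map f v) ⟩
  dealRound p k (map f v)                   ≡⟨ cong (λ r → head r ∷ deal p′ (tail r)) (rotate-map f k v) ⟩
  head (map f r) ∷ deal p′ (tail (map f r)) ≡⟨ round-map r ⟩
  map f (dealRound p k v)                   ≡⟨ cong (map f) (sym (deal-suc p v)) ⟩
  map f (deal p v)                          ∎
  where
  open ≡-Reasoning
  k = firstD p
  p′ = dropᴾ (suc k) p
  r = rotate k v
  round-map : ∀ {m} (r : Vec ℕ (suc m)) →
    head (map f r) ∷ deal p′ (tail (map f r)) ≡ map f (head r ∷ deal p′ (tail r))
  round-map (x ∷ xs) = cong (f x ∷_) (deal-map f p′ xs)

deal-D∷ᴾ : ∀ {n} P c (cs : Vec ℕ n) → deal (D ∷ᴾ P) (c ∷ cs) ≡ c ∷ deal P cs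
deal-D∷ᴾ P c cs = cong (c ∷_) (deal-cong {p = tailᴾ (D ∷ᴾ P)} {P} (λ _ → refl) cs)

deal-U∷ᴾ : ∀ {n} P c (cs : Vec ℕ n) → deal (U ∷ᴾ P) (c ∷ cs) ≡ deal P (cs ∷ʳ c)
deal-U∷ᴾ P c cs = begin
  deal (U ∷ᴾ P) (c ∷ cs)                 ≡⟨ deal-suc (U ∷ᴾ P) (c ∷ cs) ⟩
  dealRound (tailᴾ (U ∷ᴾ P)) k (cs ∷ʳ c) ≡⟨ cong (head (rotate k (cs ∷ʳ c)) ∷_) rest-cong ⟩
  dealRound P k (cs ∷ʳ c)                ≡⟨ sym (deal-suc P (cs ∷ʳ c)) ⟩
  deal P (cs ∷ʳ c)                       ∎
  where
  open ≡-Reasoning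
  k = firstD P
  p′ = dropᴾ (suc k) (tailᴾ (U ∷ᴾ P))
  q′ = dropᴾ (suc k) P
  rest = tail (rotate k (cs ∷ʳ c))
  rest-cong : deal p′ rest ≡ deal q′ rest
  rest-cong = deal-cong {p = p′} {q′} (dropᴾ-cong (suc k) {tailᴾ (U ∷ᴾ P)} {P} (λ _ → refl)) rest

indexOf-map : ∀ {n} {f : ℕ → ℕ} → Injective _≡_ _≡_ f →
  ∀ x (v : Vec ℕ n) → indexOf (f x) (map f v) ≡ indexOf x v
indexOf-map         f-inj x []       = refl
indexOf-map {f = f} f-inj x (y ∷ ys) with f x ≟ f y | x ≟ y
... | yes _     | yes _   = refl
... | yes fx≡fy | no x≢y  = contradiction (f-inj fx≡fy) x≢y
... | no fx≢fy  | yes x≡y = contradiction (cong f x≡y) fx≢fy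
... | no _      | no _    = cong suc (indexOf-map f-inj x ys)

-- cycle N is the cycle 1 ↦ 2 ↦ ⋯ ↦ N ↦ 1 on the labels of an N-card deck,
-- extended by 0 ↦ 0 and x ↦ x + 1 for x > N so that it is injective on ℕ.
cycle : ℕ → ℕ → ℕ
cycle N zero = zero
cycle N (suc x) with suc x ≟ N
... | yes _ = 1
... | no  _ = suc (suc x)

cycle-top : ∀ n → cycle (suc n) (suc n) ≡ 1
cycle-top n with suc n ≟ suc n
... | yes _        = refl
... | no 1+n≢1+n = contradiction refl 1+n≢1+n

cycle-below : ∀ {N} x → suc x < N → cycle N (suc x) ≡ suc (suc x)
cycle-below {N} x 1+x<N with suc x ≟ N
... | yes 1+x≡N = contradiction 1+x<N (<-irrefl 1+x≡N)
... | no  _     = refl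

cycle-injective : ∀ N → Injective _≡_ _≡_ (cycle N)
cycle-injective N {zero}  {zero}  _ = refl
cycle-injective N {zero}  {suc y} e with suc y ≟ N
cycle-injective N {zero}  {suc y} () | yes _
cycle-injective N {zero}  {suc y} () | no  _
cycle-injective N {suc x} {zero}  e with suc x ≟ N
cycle-injective N {suc x} {zero}  () | yes _
cycle-injective N {suc x} {zero}  () | no  _
cycle-injective N {suc x} {suc y} e with suc x ≟ N | suc y ≟ N
... | yes x≡N | yes y≡N = trans x≡N (sym y≡N)
... | no  _   | no  _   = suc-injective e
cycle-injective N {suc x} {suc y} () | yes _ | no _
cycle-injective N {suc x} {suc y} () | no _  | yes _

deckFrom-suc : ∀ s n → deckFrom (suc s) n ≡ map suc (deckFrom s n)
deckFrom-suc s zero    = refl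
deckFrom-suc s (suc n) = cong (suc s ∷_) (deckFrom-suc (suc s) n)

map-cycle-deckFrom : ∀ {N} s m → suc s + m ≡ N →
  map (cycle N) (deckFrom (suc s) (suc m)) ≡ deckFrom (suc (suc s)) m ∷ʳ 1
map-cycle-deckFrom s zero refl rewrite +-identityʳ s = cong (_∷ []) (cycle-top s)
map-cycle-deckFrom s (suc m) refl = cong₂ _∷_
  (cycle-below s (m<m+n (suc s) (s≤s z≤n)))
  (map-cycle-deckFrom (suc s) m (sym (+-suc (suc s) m)))

deal-D∷ᴾ-deck : ∀ P n → deal (D ∷ᴾ P) (deck (suc n)) ≡ 1 ∷ map suc (deal P (deck n))
deal-D∷ᴾ-deck P n = begin
  deal (D ∷ᴾ P) (deck (suc n))   ≡⟨ deal-D∷ᴾ P 1 (deckFrom 2 n) ⟩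
  1 ∷ deal P (deckFrom 2 n)      ≡⟨ cong (λ v → 1 ∷ deal P v) (deckFrom-suc 1 n) ⟩
  1 ∷ deal P (map suc (deck n))  ≡⟨ cong (1 ∷_) (deal-map suc P (deck n)) ⟩
  1 ∷ map suc (deal P (deck n))  ∎
  where open ≡-Reasoning

deal-U∷ᴾ-deck : ∀ P n → deal (U ∷ᴾ P) (deck (suc n)) ≡ map (cycle (suc n)) (deal P (deck (suc n)))
deal-U∷ᴾ-deck P n = begin
  deal (U ∷ᴾ P) (deck (suc n))                ≡⟨ deal-U∷ᴾ P 1 (deckFrom 2 n) ⟩
  deal P (deckFrom 2 n ∷ʳ 1)                  ≡⟨ cong (deal P) (sym (map-cycle-deckFrom 0 n refl)) ⟩
  deal P (map (cycle (suc n)) (deck (suc n))) ≡⟨ deal-map (cycle (suc n)) P (deck (suc n)) ⟩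
  map (cycle (suc n)) (deal P (deck (suc n))) ∎
  where open ≡-Reasoning

T-D∷ᴾ-top : ∀ P n → T (D ∷ᴾ P) (suc n) 1 ≡ 1
T-D∷ᴾ-top P n = cong (indexOf 1) (deal-D∷ᴾ-deck P n)

T-D∷ᴾ-suc : ∀ P n j → T (D ∷ᴾ P) (suc n) (suc (suc j)) ≡ suc (T P n (suc j))
T-D∷ᴾ-suc P n j = trans (cong (indexOf (suc (suc j))) (deal-D∷ᴾ-deck P n))
  (cong suc (indexOf-map suc-injective (suc j) (deal P (deck n))))

T-U∷ᴾ : ∀ P n k → T (U ∷ᴾ P) (suc n) (cycle (suc n) k) ≡ T P (suc n) k
T-U∷ᴾ P n k = trans (cong (indexOf (cycle (suc n) k)) (deal-U∷ᴾ-deck P n))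
  (indexOf-map (cycle-injective (suc n)) k (deal P (deck (suc n))))

mainTheorem3 : (P : Pattern) (N k : ℕ) → 1 ≤ k → k ≤ N →
    ((k ≡ 1 → T (D ∷ᴾ P) N k ≡ 1) ×
     (1 < k → T (D ∷ᴾ P) N k ≡ T P (N ∸ 1) (k ∸ 1) + 1)) ×
    ((k ≡ 1 → T (U ∷ᴾ P) N k ≡ T P N N) ×
     (1 < k → T (U ∷ᴾ P) N k ≡ T P N (k ∸ 1)))
mainTheorem3 P (suc n) (suc zero) _ _ =
  ((λ _ → T-D∷ᴾ-top P n) , λ { (s≤s ()) }) , ((λ _ → U-top) , λ { (s≤s ()) })
  where
  U-top : T (U ∷ᴾ P) (suc n) 1 ≡ T P (suc n) (suc n)
  U-top = trans (cong (T (U ∷ᴾ P) (suc n)) (sym (cycle-top n))) (T-U∷ᴾ P n (suc n))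
mainTheorem3 P (suc n) (suc (suc j)) _ 2+j≤1+n =
  ((λ ()) , λ _ → D-suc) , ((λ ()) , λ _ → U-suc)
  where
  D-suc : T (D ∷ᴾ P) (suc n) (suc (suc j)) ≡ T P n (suc j) + 1
  D-suc = trans (T-D∷ᴾ-suc P n j) (+-comm 1 (T P n (suc j)))
  U-suc : T (U ∷ᴾ P) (suc n) (suc (suc j)) ≡ T P (suc n) (suc j)
  U-suc = trans (cong (T (U ∷ᴾ P) (suc n)) (sym (cycle-below j 2+j≤1+n))) (T-U∷ᴾ P n (suc j))
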